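{- Let $(E,\mathcal{L})$ be a uniform oriented matroid and $X\in\mathcal{L}\setminus\{0\}$. Then the map $d:\mathcal{L}_{\ge X}\to\{+,-,0\}^{z(X)}$, $Y\mapsto Y\backslash\operatorname{supp}(X)$ (the restriction of $Y$ to $z(X)$), is an isomorphism of posets, where $\{+,-,0\}^{z(X)}$ carries the product order induced by $0<+$, $0<-$.
   Context: An oriented matroid is a pair $(E,\mathcal{L})$ with $E$ a finite set and $\mathcal{L}\subseteq\{+,-,0\}^E$ (the covectors) satisfying: (L0) $0\in\mathcal{L}$; (L1) $X\in\mathcal{L}\Rightarrow -X\in\mathcal{L}$; (L2) $X,Y\in\mathcal{L}\Rightarrow X\circ Y\in\mathcal{L}$, where $(X\circ Y)_e=X_e$ if $X_e\neq 0$ and $Y_e$ otherwise; (L3) if $X,Y\in\mathcal{L}$ and $e\in S(X,Y)=\{f: X_f=-Y_f\neq 0\}$, then there is $Z\in\mathcal{L}$ with $Z_e=0$ and $Z_f=(X\circ Y)_f$ for all $f\notin S(X,Y)$. Sign vectors are partially ordered by $Y\le X$ iff $Y_e\in\{0,X_e\}$ for all $e$ (product of the order $0<+$, $0<-$, with $+,-$ incomparable); $\mathcal{L}_{\ge X}=\{Y\in\mathcal{L}:Y\ge X\}$. For a sign vector $X$, $\operatorname{supp}(X)=\{e:X_e\neq0\}$ and $z(X)=E\setminus\operatorname{supp}(X)$. For $A\subseteq E$, $Y\backslash A$ denotes the restriction of $Y$ to $E\setminus A$. The underlying matroid has flats $\{z(X):X\in\mathcal{L}\}$ and rank $r$; $(E,\mathcal{L})$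 is uniform if every $r$-element subset of $E$ is a basis of the underlying matroid. -}

module Defs where

open import Data.Nat using (ℕ; suc)
open import Data.Fin using (Fin; zero; suc; inject₁)
open import Data.Fin.Subset using (Subset; _⊆_; _⊂_; ∣_∣; ⊤)
open import Data.Bool using (Bool; true; false)
open import Data.Vec using (Vec; lookup; tabulate; replicate; map; zipWith)
open import Data.Product using (Σ; ∃; _×_; _,_)
open import Relation.Binary.PropositionalEquality using (_≡_; _≢_)
open import Relation.Nullary using (¬_)

data Sign : Set where
  plus minus zer : Sign

negS : Sign → Sign
negS plus  = minus
negS minus = plus
negS zer   = zer

data _≤ₛ_ : Sign → Sign → Set where
  0≤ : ∀ {s} → zer ≤ₛ s
  refl≤ : ∀ {s} → s ≤ₛ s

isZero : Sign → Bool
isZero zer = true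
isZero _   = false

SignVec : ℕ → Set
SignVec n = Vec Sign n

module _ {n : ℕ} where

  zeroVec : SignVec n
  zeroVec = replicate n zer

  negV : SignVec n → SignVec n
  negV = map negS

  _∘ᵥ_ : SignVec n → SignVec n → SignVec n
  X ∘ᵥ Y = zipWith (λ x y → compose x y) X Y
    where
      compose : Sign → Sign → Sign
      compose zer y = y
      compose x   _ = x

  _≤ᵥ_ : SignVec n → SignVec n → Set
  Y ≤ᵥ X = ∀ e → lookup Y e ≤ₛ lookup X e

  Sep : SignVec n → SignVec n → Fin n → Set
  Sep X Y f = (lookup X f ≡ negS (lookup Y f)) × (lookup X f ≢ zer)

  z : SignVec n → Subset n
  z X = tabulate (λ e → isZero (lookup X e))

-- Oriented matroid given by covector axioms; 𝓛 is a predicate on sign vectors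
record IsOrientedMatroid {n : ℕ} (𝓛 : SignVec n → Set) : Set where
  field
    L0 : 𝓛 zeroVec
    L1 : ∀ X → 𝓛 X → 𝓛 (negV X)
    L2 : ∀ X Y → 𝓛 X → 𝓛 Y → 𝓛 (X ∘ᵥ Y)
    L3 : ∀ X Y e → 𝓛 X → 𝓛 Y → Sep X Y e →
         Σ (SignVec n) λ Z → 𝓛 Z × lookup Z e ≡ zer ×
           (∀ f → ¬ Sep X Y f → lookup Z f ≡ lookup (X ∘ᵥ Y) f)

module _ {n : ℕ} (𝓛 : SignVec n → Set) where

  IsFlat : Subset n → Set
  IsFlat F = Σ (SignVec n) λ X → 𝓛 X × z X ≡ F

  FlatChain : ℕ → Set
  FlatChain k = Σ (Fin (suc k) → Subset n) λ F →
    (∀ i → IsFlat (F i)) × (∀ (i : Fin k) → F (inject₁ i) ⊂ F (suc i))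

  -- the underlying matroid has rank r: the longest strict chain of flats
  -- has exactly r steps (lattice of flats is geometric, height r)
  HasRank : ℕ → Set
  HasRank r = FlatChain r × ¬ FlatChain (suc r)

  Spanning : Subset n → Set
  Spanning B = ∀ F → IsFlat F → B ⊆ F → F ≡ ⊤

  IsBasis : ℕ → Subset n → Set
  IsBasis r B = ∣ B ∣ ≡ r × Spanning B

  IsUniform : Set
  IsUniform = Σ ℕ λ r → HasRank r × (∀ B → ∣ B ∣ ≡ r → IsBasis r B)

  ZeroIdx : SignVec n → Set
  ZeroIdx X = Σ (Fin n) λ e → lookup X e ≡ zer

  restrict : (X : SignVec n) → SignVec n → ZeroIdx X → Sign
  restrict X Y (e , _) = lookup Y e

  LeZ : (X : SignVec n) → (ZeroIdx X → Sign) → (ZeroIdx X → Sign) → Set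
  LeZ X U V = ∀ i → U i ≤ₛ V i

  EqZ : (X : SignVec n) → (ZeroIdx X → Sign) → (ZeroIdx X → Sign) → Set
  EqZ X U V = ∀ i → U i ≡ V i

  IsPosetIso : SignVec n → Set
  IsPosetIso X =
    (∀ Y Y' → 𝓛 Y → X ≤ᵥ Y → 𝓛 Y' → X ≤ᵥ Y' →
       (Y ≤ᵥ Y' → LeZ X (restrict X Y) (restrict X Y')) ×
       (LeZ X (restrict X Y) (restrict X Y') → Y ≤ᵥ Y') ×
       (EqZ X (restrict X Y) (restrict X Y') → Y ≡ Y')) ×
    (∀ (W : ZeroIdx X → Sign) →
       Σ (SignVec n) λ Y → 𝓛 Y × X ≤ᵥ Y × EqZ X (restrict X Y) W)

{-# OPTIONS --safe #-}
-- Covectors Y ≥ X agree with X on supp X, so restriction to z(X) is an order embedding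
-- of 𝓛_{≥X}, and the work is surjectivity. A maximal chain of flats yields r covectors in
-- triangular position with respect to r pivots, and covector elimination (L3) lets such a
-- family absorb one more common zero at the price of one member. In a uniform oriented
-- matroid no nonzero covector vanishes on an r-set, so the family survives absorbing
-- z(X) − e, and it cannot absorb e as well: some member is nonzero at e while vanishing on
-- z(X) − e. Composing X with these covectors for all e ∈ z(X), each negated or replaced by
-- 0 as required, realises every sign vector on z(X).
module Submission where

open import Defs
open import Axiom.UniquenessOfIdentityProofs using (module Decidable⇒UIP)
open import Data.Bool using (true)
open import Data.Empty using (⊥-elim)
open import Data.Fin using (Fin; zero; suc; inject₁; fromℕ; _≟_)
open import Data.Fin.Subset using (Subset; _∈_; _∉_; ∣_∣; ⊤; ⊥; ⁅_⁆; _∪_; inside; outside)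
open import Data.Fin.Subset.Properties
  using (∉⊥; ∈⊤; ∣⊥∣≡0; _∈?_; x∈⁅x⁆; x∈⁅y⁆⇒x≡y; x∈p∪q⁻; x∈p∪q⁺; p⊆p∪q; ∪-identityʳ)
open import Data.List using (List; []; _∷_; length; foldr; tabulate; allFin)
open import Data.List.Membership.Propositional using () renaming (_∈_ to _∈ₗ_)
open import Data.List.Membership.Propositional.Properties using (∈-allFin)
open import Data.List.Relation.Binary.Subset.Propositional using () renaming (_⊆_ to _⊆ₗ_)
open import Data.List.Relation.Binary.Subset.Propositional.Properties using (∷⁺ʳ)
open import Data.List.Relation.Unary.All using (All; []; _∷_)
import Data.List.Relation.Unary.All.Properties as All
open import Data.List.Relation.Unary.Any using (Any; here; there)
import Data.List.Relation.Unary.Any.Properties as Any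
open import Data.Nat using (ℕ; zero; suc; _+_)
open import Data.Nat.Properties using (+-suc; +-identityʳ; suc-injective)
open import Data.Product using (∃; _×_; _,_; proj₁; proj₂)
open import Data.Sum using (_⊎_; inj₁; inj₂; [_,_]′)
import Data.Sum as Sum
open import Data.Vec using (_∷_; lookup; here; there)
open import Data.Vec.Properties using (lookup-map; lookup-replicate; lookup∘tabulate; []=⇒lookup; lookup⇒[]=)
open import Data.Vec.Relation.Binary.Pointwise.Extensional using (ext; Pointwise-≡⇒≡)
open import Function using (_∘_)
open import Relation.Binary.Definitions using (DecidableEquality)
open import Relation.Binary.PropositionalEquality
open import Relation.Nullary using (¬_; yes; no; ¬?; _×-dec_; contradiction)
open import Relation.Unary using (Decidable)

_≟ₛ_ : DecidableEquality Sign
plus  ≟ₛ plus  = yes refl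
plus  ≟ₛ minus = no λ ()
plus  ≟ₛ zer   = no λ ()
minus ≟ₛ plus  = no λ ()
minus ≟ₛ minus = yes refl
minus ≟ₛ zer   = no λ ()
zer   ≟ₛ plus  = no λ ()
zer   ≟ₛ minus = no λ ()
zer   ≟ₛ zer   = yes refl

open Decidable⇒UIP _≟ₛ_ using (≡-irrelevant)

-- The sign operation behind _∘ᵥ_, whose own copy is local to its definition.
infixr 25 _∘ₛ_
_∘ₛ_ : Sign → Sign → Sign
zer   ∘ₛ t = t
plus  ∘ₛ _ = plus
minus ∘ₛ _ = minus

∘ₛ-nonzeroˡ : ∀ {s} t → s ≢ zer → s ∘ₛ t ≡ s
∘ₛ-nonzeroˡ {plus}  _ _    = refl
∘ₛ-nonzeroˡ {minus} _ _    = refl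
∘ₛ-nonzeroˡ {zer}   _ s≢0 = contradiction refl s≢0

∘ₛ-idem : ∀ s → s ∘ₛ s ≡ s
∘ₛ-idem plus  = refl
∘ₛ-idem minus = refl
∘ₛ-idem zer   = refl

negS-involutive : ∀ s → negS (negS s) ≡ s
negS-involutive plus  = refl
negS-involutive minus = refl
negS-involutive zer   = refl

negS-nonzero : ∀ {s} → s ≢ zer → negS s ≢ zer
negS-nonzero {plus}  _   ()
negS-nonzero {minus} _   ()
negS-nonzero {zer}   s≢0 _ = s≢0 refl

≡negS⇒≡zer : ∀ {s} → s ≡ negS s → s ≡ zer
≡negS⇒≡zer {zer} _ = refl

isZero≡true⇒≡zer : ∀ {s} → isZero s ≡ true → s ≡ zer
isZero≡true⇒≡zer {zer} _ = refl

sign-trichotomy : ∀ {v} → v ≢ zer → ∀ s → s ≡ zer ⊎ s ≡ v ⊎ s ≡ negS v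
sign-trichotomy {plus}  _ plus  = inj₂ (inj₁ refl)
sign-trichotomy {plus}  _ minus = inj₂ (inj₂ refl)
sign-trichotomy {minus} _ plus  = inj₂ (inj₂ refl)
sign-trichotomy {minus} _ minus = inj₂ (inj₁ refl)
sign-trichotomy         _ zer   = inj₁ refl
sign-trichotomy {zer} v≢0 _     = contradiction refl v≢0

≤ₛ-reflexive : ∀ {s t} → s ≡ t → s ≤ₛ t
≤ₛ-reflexive refl = refl≤

≡zer⇒≤ₛ : ∀ {s t} → s ≡ zer → s ≤ₛ t
≡zer⇒≤ₛ refl = 0≤

≤ₛ-antisym : ∀ {s t} → s ≤ₛ t → t ≤ₛ s → s ≡ t
≤ₛ-antisym 0≤    0≤ = refl
≤ₛ-antisym 0≤    refl≤ = refl
≤ₛ-antisym refl≤ _  = refl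

≤ₛ-nonzero : ∀ {s t} → s ≤ₛ t → s ≢ zer → t ≡ s
≤ₛ-nonzero 0≤    s≢0 = contradiction refl s≢0
≤ₛ-nonzero refl≤ _   = refl

≤ₛ-∘ₛ : ∀ s t → s ≤ₛ s ∘ₛ t
≤ₛ-∘ₛ zer   _ = 0≤
≤ₛ-∘ₛ plus  _ = refl≤
≤ₛ-∘ₛ minus _ = refl≤

∘ₛ-≤ : ∀ {s t u} → s ≤ₛ u → t ≤ₛ u → s ∘ₛ t ≤ₛ u
∘ₛ-≤ 0≤ t≤u = t≤u
∘ₛ-≤ {u = zer}   refl≤ t≤u = t≤u
∘ₛ-≤ {u = plus}  refl≤ _   = refl≤
∘ₛ-≤ {u = minus} refl≤ _   = refl≤

∘ₛ-≡ˡ : ∀ {s t} → t ≤ₛ s → s ∘ₛ t ≡ s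
∘ₛ-≡ˡ {zer}   0≤    = refl
∘ₛ-≡ˡ {zer}   refl≤ = refl
∘ₛ-≡ˡ {plus}  _     = refl
∘ₛ-≡ˡ {minus} _     = refl

∘ₛ-≡ʳ : ∀ {s t} → s ≤ₛ t → s ∘ₛ t ≡ t
∘ₛ-≡ʳ 0≤    = refl
∘ₛ-≡ʳ refl≤ = ∘ₛ-idem _

lookup-∘ᵥ : ∀ {n} (X Y : SignVec n) i → lookup (X ∘ᵥ Y) i ≡ lookup X i ∘ₛ lookup Y i
lookup-∘ᵥ (plus  ∷ _) (_ ∷ _) zero    = refl
lookup-∘ᵥ (minus ∷ _) (_ ∷ _) zero    = refl
lookup-∘ᵥ (zer   ∷ _) (_ ∷ _) zero    = refl
lookup-∘ᵥ (_ ∷ X)     (_ ∷ Y) (suc i) = lookup-∘ᵥ X Y i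

∣p∪⁅x⁆∣≡1+∣p∣ : ∀ {n} {p : Subset n} {x} → x ∉ p → ∣ p ∪ ⁅ x ⁆ ∣ ≡ suc ∣ p ∣
∣p∪⁅x⁆∣≡1+∣p∣ {p = inside  ∷ _} {zero}  x∉p = ⊥-elim (x∉p here)
∣p∪⁅x⁆∣≡1+∣p∣ {p = outside ∷ p} {zero}  _   = cong (suc ∘ ∣_∣) (∪-identityʳ p)
∣p∪⁅x⁆∣≡1+∣p∣ {p = inside  ∷ _} {suc _} x∉p = cong suc (∣p∪⁅x⁆∣≡1+∣p∣ (x∉p ∘ there))
∣p∪⁅x⁆∣≡1+∣p∣ {p = outside ∷ _} {suc _} x∉p = ∣p∪⁅x⁆∣≡1+∣p∣ (x∉p ∘ there)

∣p∪⁅x⁆∣+k : ∀ {n} {p : Subset n} {x} k → x ∉ p → ∣ p ∪ ⁅ x ⁆ ∣ + k ≡ ∣ p ∣ + suc k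
∣p∪⁅x⁆∣+k k x∉p = trans (cong (_+ k) (∣p∪⁅x⁆∣≡1+∣p∣ x∉p)) (sym (+-suc _ k))

∈p∪⁅x⁆-elim : ∀ {n} {P : Fin n → Set} {p x} → (∀ {i} → i ∈ p → P i) → P x →
  ∀ {i} → i ∈ p ∪ ⁅ x ⁆ → P i
∈p∪⁅x⁆-elim {P = P} {p} {x} p⊆P Px i∈ =
  [ p⊆P , (λ i∈x → subst P (sym (x∈⁅y⁆⇒x≡y x i∈x)) Px) ]′ (x∈p∪q⁻ p ⁅ x ⁆ i∈)

module _ {n : ℕ} where

  lookup-zeroVec : ∀ i → lookup (zeroVec {n}) i ≡ zer
  lookup-zeroVec i = lookup-replicate i zer

  lookup-negV : ∀ (X : SignVec n) i → lookup (negV X) i ≡ negS (lookup X i)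
  lookup-negV X i = lookup-map i negS X

  lookup-∘ᵥ-zeroˡ : ∀ (X Y : SignVec n) {i} → lookup X i ≡ zer → lookup (X ∘ᵥ Y) i ≡ lookup Y i
  lookup-∘ᵥ-zeroˡ X Y {i} Xi≡0 = trans (lookup-∘ᵥ X Y i) (cong (_∘ₛ lookup Y i) Xi≡0)

  lookup-∘ᵥ-nonzeroˡ : ∀ (X Y : SignVec n) {i} → lookup X i ≢ zer → lookup (X ∘ᵥ Y) i ≡ lookup X i
  lookup-∘ᵥ-nonzeroˡ X Y {i} Xi≢0 = trans (lookup-∘ᵥ X Y i) (∘ₛ-nonzeroˡ _ Xi≢0)

  ≤ᵥ-antisym : ∀ {X Y : SignVec n} → X ≤ᵥ Y → Y ≤ᵥ X → X ≡ Y
  ≤ᵥ-antisym X≤Y Y≤X = Pointwise-≡⇒≡ (ext λ i → ≤ₛ-antisym (X≤Y i) (Y≤X i))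

  ≤ᵥ-∘ᵥ : ∀ (X Y : SignVec n) → X ≤ᵥ (X ∘ᵥ Y)
  ≤ᵥ-∘ᵥ X Y i = subst (lookup X i ≤ₛ_) (sym (lookup-∘ᵥ X Y i)) (≤ₛ-∘ₛ _ _)

  ∈z⇒≡zer : ∀ (X : SignVec n) {i} → i ∈ z X → lookup X i ≡ zer
  ∈z⇒≡zer X {i} i∈zX =
    isZero≡true⇒≡zer (trans (sym (lookup∘tabulate (isZero ∘ lookup X) i)) ([]=⇒lookup i∈zX))

  ≡zer⇒∈z : ∀ (X : SignVec n) {i} → lookup X i ≡ zer → i ∈ z X
  ≡zer⇒∈z X {i} Xi≡0 =
    lookup⇒[]= i (z X) (trans (lookup∘tabulate (isZero ∘ lookup X) i) (cong isZero Xi≡0))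

  Vanishes : (Fin n → Set) → SignVec n → Set
  Vanishes P D = ∀ {i} → P i → lookup D i ≡ zer

  composeAll : List (SignVec n) → SignVec n
  composeAll = foldr _∘ᵥ_ zeroVec

  lookup-composeAll-≤ : ∀ {Ts f s} → All (λ T → lookup T f ≤ₛ s) Ts → lookup (composeAll Ts) f ≤ₛ s
  lookup-composeAll-≤ {f = f} [] = ≡zer⇒≤ₛ (lookup-zeroVec f)
  lookup-composeAll-≤ {T ∷ Ts} {f} (Tf≤s ∷ Ts≤s) =
    subst (_≤ₛ _) (sym (lookup-∘ᵥ T (composeAll Ts) f)) (∘ₛ-≤ Tf≤s (lookup-composeAll-≤ Ts≤s))

  -- The coordinate f of a composition is its first nonzero one; when all of them are ≤ s,
  -- any occurrence of s is therefore the result.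
  lookup-composeAll : ∀ {Ts f s} → All (λ T → lookup T f ≤ₛ s) Ts → Any (λ T → lookup T f ≡ s) Ts →
    lookup (composeAll Ts) f ≡ s
  lookup-composeAll {T ∷ Ts} {f} (_ ∷ Ts≤s) (here Tf≡s) =
    trans (lookup-∘ᵥ T (composeAll Ts) f)
      (trans (cong (_∘ₛ _) Tf≡s) (∘ₛ-≡ˡ (lookup-composeAll-≤ Ts≤s)))
  lookup-composeAll {T ∷ Ts} {f} (Tf≤s ∷ Ts≤s) (there s∈Ts) =
    trans (lookup-∘ᵥ T (composeAll Ts) f)
      (trans (cong (_ ∘ₛ_) (lookup-composeAll Ts≤s s∈Ts)) (∘ₛ-≡ʳ Tf≤s))

module _ {n : ℕ} (𝓛 : SignVec n → Set) where

  restrict-reflects : ∀ {X Y Y′} → X ≤ᵥ Y → X ≤ᵥ Y′ →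
    LeZ 𝓛 X (restrict 𝓛 X Y) (restrict 𝓛 X Y′) → Y ≤ᵥ Y′
  restrict-reflects {X} X≤Y X≤Y′ dY≤dY′ f with lookup X f ≟ₛ zer
  ... | yes Xf≡0 = dY≤dY′ (f , Xf≡0)
  ... | no  Xf≢0 = ≤ₛ-reflexive (trans (≤ₛ-nonzero (X≤Y f) Xf≢0) (sym (≤ₛ-nonzero (X≤Y′ f) Xf≢0)))

  restrict-injective : ∀ {X Y Y′} → X ≤ᵥ Y → X ≤ᵥ Y′ →
    EqZ 𝓛 X (restrict 𝓛 X Y) (restrict 𝓛 X Y′) → Y ≡ Y′
  restrict-injective {X} {Y} {Y′} X≤Y X≤Y′ dY≡dY′ = ≤ᵥ-antisym
    (restrict-reflects {X} {Y} {Y′} X≤Y X≤Y′ (≤ₛ-reflexive ∘ dY≡dY′))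
    (restrict-reflects {X} {Y′} {Y} X≤Y′ X≤Y (≤ₛ-reflexive ∘ sym ∘ dY≡dY′))

module OrientedMatroid {n : ℕ} {𝓛 : SignVec n → Set} (om : IsOrientedMatroid 𝓛) where
  open IsOrientedMatroid om

  elimination : ∀ {U Y b} → 𝓛 U → 𝓛 Y → lookup Y b ≢ zer →
    ∃ λ Z → 𝓛 Z × lookup Z b ≡ zer × (∀ {g} → lookup Y g ≡ zer → lookup Z g ≡ lookup U g)
  elimination {U} {Y} {b} U∈ Y∈ Yb≢0 =
    let Z , Z∈ , Zb≡0 , Z-agrees = L3 Y⁺ Y⁻ b (L2 _ _ Y∈ U∈) (L2 _ _ (L1 _ Y∈) U∈) separated-at-b
    in Z , Z∈ , Zb≡0 , λ {g} Yg≡0 → begin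
      lookup Z g                          ≡⟨ Z-agrees g (not-separated Yg≡0) ⟩
      lookup (Y⁺ ∘ᵥ Y⁻) g                 ≡⟨ lookup-∘ᵥ Y⁺ Y⁻ g ⟩
      lookup Y⁺ g ∘ₛ lookup Y⁻ g          ≡⟨ cong₂ _∘ₛ_ (Y⁺-off Yg≡0) (Y⁻-off Yg≡0) ⟩
      lookup U g ∘ₛ lookup U g            ≡⟨ ∘ₛ-idem _ ⟩
      lookup U g                          ∎
    where
    open ≡-Reasoning
    Y⁺ Y⁻ : SignVec n
    Y⁺ = Y ∘ᵥ U
    Y⁻ = negV Y ∘ᵥ U

    Y⁺-off : ∀ {g} → lookup Y g ≡ zer → lookup Y⁺ g ≡ lookup U g
    Y⁺-off = lookup-∘ᵥ-zeroˡ Y U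

    Y⁻-off : ∀ {g} → lookup Y g ≡ zer → lookup Y⁻ g ≡ lookup U g
    Y⁻-off {g} Yg≡0 = lookup-∘ᵥ-zeroˡ (negV Y) U (trans (lookup-negV Y g) (cong negS Yg≡0))

    Y⁺-at-b : lookup Y⁺ b ≡ lookup Y b
    Y⁺-at-b = lookup-∘ᵥ-nonzeroˡ Y U Yb≢0

    Y⁻-at-b : lookup Y⁻ b ≡ negS (lookup Y b)
    Y⁻-at-b = trans (lookup-∘ᵥ-nonzeroˡ (negV Y) U (subst (_≢ zer) (sym (lookup-negV Y b)) (negS-nonzero Yb≢0)))
                    (lookup-negV Y b)

    separated-at-b : Sep Y⁺ Y⁻ b
    separated-at-b = opposite , λ Y⁺b≡0 → Yb≢0 (trans (sym Y⁺-at-b) Y⁺b≡0)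
      where
      opposite : lookup Y⁺ b ≡ negS (lookup Y⁻ b)
      opposite = begin
        lookup Y⁺ b                  ≡⟨ Y⁺-at-b ⟩
        lookup Y b                   ≡⟨ negS-involutive _ ⟨
        negS (negS (lookup Y b))     ≡⟨ cong negS Y⁻-at-b ⟨
        negS (lookup Y⁻ b)           ∎

    not-separated : ∀ {g} → lookup Y g ≡ zer → ¬ Sep Y⁺ Y⁻ g
    not-separated {g} Yg≡0 (opposite , Y⁺g≢0) = Y⁺g≢0 (≡negS⇒≡zer (begin
      lookup Y⁺ g          ≡⟨ opposite ⟩
      negS (lookup Y⁻ g)   ≡⟨ cong negS (trans (Y⁻-off Yg≡0) (sym (Y⁺-off Yg≡0))) ⟩
      negS (lookup Y⁺ g)   ∎))

  -- A certificate that the pivots c₁ … c_k are independent in the contraction of the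
  -- underlying matroid by A: covectors D_i vanishing on A and on c_{i+1} … c_k, but not at c_i.
  data IndependentOver (A : Subset n) : List (Fin n) → Set where
    [] : IndependentOver A []
    cons : ∀ {c cs} D → 𝓛 D → Vanishes (_∈ A) D → lookup D c ≢ zer → Vanishes (_∈ₗ cs) D →
           IndependentOver A cs → IndependentOver A (c ∷ cs)

  eliminate : ∀ {A b cs} D → 𝓛 D → Vanishes (_∈ A) D → lookup D b ≢ zer → Vanishes (_∈ₗ cs) D →
    IndependentOver A cs → IndependentOver (A ∪ ⁅ b ⁆) cs
  eliminate D D∈ D|A Db≢0 D|cs [] = []
  eliminate D D∈ D|A Db≢0 D|cs (cons U U∈ U|A Uc≢0 U|cs I) =
    let Z , Z∈ , Zb≡0 , Z≡U = elimination U∈ D∈ Db≢0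
        Z-vanishes : ∀ {i} → lookup D i ≡ zer → lookup U i ≡ zer → lookup Z i ≡ zer
        Z-vanishes Di≡0 Ui≡0 = trans (Z≡U Di≡0) Ui≡0
    in cons Z Z∈ (∈p∪⁅x⁆-elim (λ i∈A → Z-vanishes (D|A i∈A) (U|A i∈A)) Zb≡0)
         (λ Zc≡0 → Uc≢0 (trans (sym (Z≡U (D|cs (here refl)))) Zc≡0))
         (λ i∈cs → Z-vanishes (D|cs (there i∈cs)) (U|cs i∈cs))
         (eliminate D D∈ D|A Db≢0 (D|cs ∘ there) I)

  -- One pivot is dropped: the first one whose covector is nonzero at b, which then
  -- eliminates b from the later covectors, or failing that the last one.
  extend : ∀ {A c cs} b → IndependentOver A (c ∷ cs) →
    ∃ λ cs′ → IndependentOver (A ∪ ⁅ b ⁆) cs′ × length cs′ ≡ length cs × cs′ ⊆ₗ c ∷ cs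
  extend b (cons D D∈ D|A Dc≢0 D|cs I) with lookup D b ≟ₛ zer
  ... | no Db≢0 = _ , eliminate D D∈ D|A Db≢0 D|cs I , refl , there
  extend b (cons D D∈ D|A Dc≢0 D|cs []) | yes Db≡0 = [] , [] , refl , λ ()
  extend b (cons D D∈ D|A Dc≢0 D|cs I@(cons _ _ _ _ _ _)) | yes Db≡0 =
    let cs′ , I′ , same-length , cs′⊆cs = extend b I
    in _ , cons D D∈ (∈p∪⁅x⁆-elim D|A Db≡0) Dc≢0 (D|cs ∘ cs′⊆cs) I′ ,
       cong suc same-length , ∷⁺ʳ _ cs′⊆cs

  Separates : Subset n → Fin n → Set
  Separates A e = ∃ λ D → 𝓛 D × Vanishes (_∈ A) D × lookup D e ≢ zer

  separates⊎independent : ∀ {A cs} e → IndependentOver A cs →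
    Separates A e ⊎ IndependentOver (A ∪ ⁅ e ⁆) cs
  separates⊎independent e [] = inj₂ []
  separates⊎independent e (cons D D∈ D|A Dc≢0 D|cs I) with lookup D e ≟ₛ zer
  ... | no  De≢0 = inj₁ (D , D∈ , D|A , De≢0)
  ... | yes De≡0 =
    Sum.map₂ (cons D D∈ (∈p∪⁅x⁆-elim D|A De≡0) Dc≢0 D|cs) (separates⊎independent e I)

  chain-top : ∀ {k} → FlatChain 𝓛 k → Subset n
  chain-top {k} (F , _) = F (fromℕ k)

  chain-init : ∀ {k} → FlatChain 𝓛 (suc k) → FlatChain 𝓛 k
  chain-init (F , flat , step) = F ∘ inject₁ , flat ∘ inject₁ , step ∘ inject₁

  -- The pivot of the i-th step is a point of F_{i+1} outside F_i = z(D_i).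
  chain-pivots : ∀ {k} (chain : FlatChain 𝓛 k) →
    ∃ λ cs → IndependentOver ⊥ cs × length cs ≡ k × (∀ {c} → c ∈ₗ cs → c ∈ chain-top chain)
  chain-pivots {zero} _ = [] , [] , refl , λ ()
  chain-pivots {suc k} chain@(F , flat , step) =
    let cs , I , len , cs⊆F = chain-pivots (chain-init chain)
        D , D∈ , zD≡F = flat (inject₁ (fromℕ k))
        F⊆F′ , c , c∈F′ , c∉F = step (fromℕ k)
    in c ∷ cs ,
       cons D D∈ (λ i∈⊥ → contradiction i∈⊥ ∉⊥)
         (λ Dc≡0 → c∉F (subst (c ∈_) zD≡F (≡zer⇒∈z D Dc≡0)))
         (λ i∈cs → ∈z⇒≡zer D (subst (_ ∈_) (sym zD≡F) (cs⊆F i∈cs))) I ,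
       cong suc len ,
       λ { (here refl) → c∈F′ ; (there i∈cs) → F⊆F′ (cs⊆F i∈cs) }

  signed : ∀ {V e} → 𝓛 V → lookup V e ≢ zer → ∀ s →
    ∃ λ T → 𝓛 T × lookup T e ≡ s × Vanishes (λ f → lookup V f ≡ zer) T
  signed {V} {e} V∈ Ve≢0 s with sign-trichotomy Ve≢0 s
  ... | inj₁ s≡0 = zeroVec , L0 , trans (lookup-zeroVec e) (sym s≡0) , λ {f} _ → lookup-zeroVec f
  ... | inj₂ (inj₁ s≡Ve) = V , V∈ , sym s≡Ve , λ Vf≡0 → Vf≡0
  ... | inj₂ (inj₂ s≡-Ve) =
    negV V , L1 V V∈ , trans (lookup-negV V e) (sym s≡-Ve) ,
    λ {f} Vf≡0 → trans (lookup-negV V f) (cong negS Vf≡0)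

  composeAll-covector : ∀ {Ts} → All 𝓛 Ts → 𝓛 (composeAll Ts)
  composeAll-covector [] = L0
  composeAll-covector (T∈ ∷ Ts∈) = L2 _ _ T∈ (composeAll-covector Ts∈)

  module Uniform {r} (chain : FlatChain 𝓛 r) (bases : ∀ B → ∣ B ∣ ≡ r → IsBasis 𝓛 r B) where

    vanishes-on-basis : ∀ {B D} → 𝓛 D → Vanishes (_∈ B) D → ∣ B ∣ ≡ r → ∀ i → lookup D i ≡ zer
    vanishes-on-basis {B} {D} D∈ D|B ∣B∣≡r i = ∈z⇒≡zer D (subst (i ∈_) (sym zD≡⊤) ∈⊤)
      where
      zD≡⊤ : z D ≡ ⊤
      zD≡⊤ = proj₂ (bases B ∣B∣≡r) (z D) (D , D∈ , refl) (≡zer⇒∈z D ∘ D|B)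

    ∣vanishing-set∣≢r : ∀ {A X} → 𝓛 X → X ≢ zeroVec → Vanishes (_∈ A) X → ∣ A ∣ ≢ r
    ∣vanishing-set∣≢r X∈ X≢0 X|A ∣A∣≡r =
      X≢0 (Pointwise-≡⇒≡ (ext λ i → trans (vanishes-on-basis X∈ X|A ∣A∣≡r i) (sym (lookup-zeroVec i))))

    independent-bound : ∀ k {A c cs} → length cs ≡ k → IndependentOver A (c ∷ cs) → ∣ A ∣ + k ≢ r
    independent-bound zero _ (cons D D∈ D|A Dc≢0 _ _) ∣A∣+0≡r =
      Dc≢0 (vanishes-on-basis D∈ D|A (trans (sym (+-identityʳ _)) ∣A∣+0≡r) _)
    independent-bound (suc k) {c = c} len I@(cons _ _ D|A Dc≢0 _ _) ∣A∣+k≡r with extend c I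
    ... | [] , _ , len′ , _ = contradiction (trans len′ len) λ ()
    ... | _ ∷ _ , I′ , len′ , _ =
      independent-bound k (suc-injective (trans len′ len)) I′
        (trans (∣p∪⁅x⁆∣+k k (λ c∈A → Dc≢0 (D|A c∈A))) ∣A∣+k≡r)

    -- A is part of a certified basis: A together with the pivots of a certificate over A has size r.
    Tight : Subset n → Set
    Tight A = ∃ λ cs → IndependentOver A cs × ∣ A ∣ + length cs ≡ r

    tight-⊥ : Tight ⊥
    tight-⊥ = let cs , I , len , _ = chain-pivots chain in cs , I , cong₂ _+_ (∣⊥∣≡0 n) len

    tight-∪⁅⁆ : ∀ {A b} → Tight A → b ∉ A → ∣ A ∣ ≢ r → Tight (A ∪ ⁅ b ⁆)
    tight-∪⁅⁆ ([] , _ , ∣A∣+0≡r) _ ∣A∣≢r = contradiction (trans (sym (+-identityʳ _)) ∣A∣+0≡r) ∣A∣≢r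
    tight-∪⁅⁆ {A} {b} (_ ∷ cs , I , ∣A∣+k≡r) b∉A _ =
      let cs′ , I′ , len , _ = extend b I
      in cs′ , I′ , trans (cong (∣ A ∪ ⁅ b ⁆ ∣ +_) len) (trans (∣p∪⁅x⁆∣+k (length cs) b∉A) ∣A∣+k≡r)

    tight⇒separates : ∀ {A e} → Tight A → e ∉ A → ∣ A ∣ ≢ r → Separates A e
    tight⇒separates ([] , _ , ∣A∣+0≡r) _ ∣A∣≢r = contradiction (trans (sym (+-identityʳ _)) ∣A∣+0≡r) ∣A∣≢r
    tight⇒separates {e = e} (_ ∷ cs , I , ∣A∣+k≡r) e∉A _ with separates⊎independent e I
    ... | inj₁ separates = separates
    ... | inj₂ I′ =
      contradiction (trans (∣p∪⁅x⁆∣+k (length cs) e∉A) ∣A∣+k≡r) (independent-bound _ refl I′)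

    tight-cover : ∀ {P : Fin n → Set} → Decidable P → (∀ {A} → (∀ {i} → i ∈ A → P i) → ∣ A ∣ ≢ r) →
      ∃ λ A → Tight A × (∀ {i} → i ∈ A → P i) × (∀ {i} → P i → i ∈ A)
    tight-cover {P} P? small =
      let A , A-tight , A⊆P , covers = cover (allFin n)
      in A , A-tight , A⊆P , covers (∈-allFin _)
      where
      cover : ∀ ℓ → ∃ λ A → Tight A × (∀ {i} → i ∈ A → P i) × (∀ {i} → i ∈ₗ ℓ → P i → i ∈ A)
      cover [] = ⊥ , tight-⊥ , (λ i∈⊥ → contradiction i∈⊥ ∉⊥) , λ ()
      cover (j ∷ ℓ) with cover ℓ | P? j
      ... | A , A-tight , A⊆P , covers | no ¬Pj =
        A , A-tight , A⊆P , λ { (here refl) Pj → contradiction Pj ¬Pj ; (there i∈ℓ) → covers i∈ℓ }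
      ... | A , A-tight , A⊆P , covers | yes Pj with j ∈? A
      ...   | yes j∈A = A , A-tight , A⊆P , λ { (here refl) _ → j∈A ; (there i∈ℓ) → covers i∈ℓ }
      ...   | no  j∉A =
        A ∪ ⁅ j ⁆ , tight-∪⁅⁆ A-tight j∉A (small A⊆P) , ∈p∪⁅x⁆-elim A⊆P Pj ,
        λ { (here refl) _ → x∈p∪q⁺ (inj₂ (x∈⁅x⁆ j)) ; (there i∈ℓ) Pi → p⊆p∪q ⁅ j ⁆ (covers i∈ℓ Pi) }

    isolating-covector : ∀ {X} e → 𝓛 X → X ≢ zeroVec →
      ∃ λ V → 𝓛 V × lookup V e ≢ zer × Vanishes (λ f → lookup X f ≡ zer × f ≢ e) V
    isolating-covector {X} e X∈ X≢0 =
      let A , A-tight , A⊆P , P⊆A = tight-cover P? small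
          V , V∈ , V|A , Ve≢0 = tight⇒separates A-tight (λ e∈A → proj₂ (A⊆P e∈A) refl) (small A⊆P)
      in V , V∈ , Ve≢0 , V|A ∘ P⊆A
      where
      P : Fin n → Set
      P f = lookup X f ≡ zer × f ≢ e

      P? : Decidable P
      P? f = (lookup X f ≟ₛ zer) ×-dec ¬? (f ≟ e)

      small : ∀ {A} → (∀ {i} → i ∈ A → P i) → ∣ A ∣ ≢ r
      small A⊆P = ∣vanishing-set∣≢r X∈ X≢0 (proj₁ ∘ A⊆P)

    restrict-surjective : ∀ {X} → 𝓛 X → X ≢ zeroVec → ∀ (W : ZeroIdx 𝓛 X → Sign) →
      ∃ λ Y → 𝓛 Y × X ≤ᵥ Y × EqZ 𝓛 X (restrict 𝓛 X Y) W
    restrict-surjective {X} X∈ X≢0 W =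
      composeAll (X ∷ Ts) , composeAll-covector (X∈ ∷ All.tabulate⁺ (proj₁ ∘ proj₂ ∘ component)) ,
      ≤ᵥ-∘ᵥ X (composeAll Ts) ,
      λ (f , Xf≡0) → lookup-composeAll {Ts = X ∷ Ts} {f = f} (≡zer⇒≤ₛ Xf≡0 ∷ All.tabulate⁺ (λ e → bounded e Xf≡0))
                                      (there (Any.tabulate⁺ f (attains f Xf≡0)))
      where
      component : ∀ e → ∃ λ T → 𝓛 T × (∀ p → lookup T e ≡ W (e , p)) ×
                                Vanishes (λ f → lookup X f ≡ zer × f ≢ e) T
      component e with lookup X e ≟ₛ zer
      ... | no Xe≢0 = zeroVec , L0 , (λ p → contradiction p Xe≢0) , λ {f} _ → lookup-zeroVec f
      ... | yes Xe≡0 =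
        let V , V∈ , Ve≢0 , V|P = isolating-covector {X} e X∈ X≢0
            T , T∈ , Te≡ , T|V = signed V∈ Ve≢0 (W (e , Xe≡0))
        in T , T∈ , (λ p → subst (λ q → lookup T e ≡ W (e , q)) (≡-irrelevant Xe≡0 p) Te≡) , T|V ∘ V|P

      Ts : List (SignVec n)
      Ts = tabulate (proj₁ ∘ component)

      attains : ∀ f (Xf≡0 : lookup X f ≡ zer) → lookup (proj₁ (component f)) f ≡ W (f , Xf≡0)
      attains f = proj₁ (proj₂ (proj₂ (component f)))

      bounded : ∀ e {f} (Xf≡0 : lookup X f ≡ zer) → lookup (proj₁ (component e)) f ≤ₛ W (f , Xf≡0)
      bounded e {f} Xf≡0 with f ≟ e
      ... | yes refl = ≤ₛ-reflexive (attains f Xf≡0)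
      ... | no  f≢e  = ≡zer⇒≤ₛ (proj₂ (proj₂ (proj₂ (component e))) (Xf≡0 , f≢e))

lemma4p1 : (n : ℕ) (𝓛 : SignVec n → Set) →
    IsOrientedMatroid 𝓛 → IsUniform 𝓛 →
    (X : SignVec n) → 𝓛 X → X ≢ zeroVec →
    IsPosetIso 𝓛 X
lemma4p1 n 𝓛 om (r , (chain , _) , bases) X X∈ X≢0 =
  (λ Y Y′ _ X≤Y _ X≤Y′ →
     (λ Y≤Y′ (f , _) → Y≤Y′ f) ,
     restrict-reflects 𝓛 {X} {Y} {Y′} X≤Y X≤Y′ ,
     restrict-injective 𝓛 {X} {Y} {Y′} X≤Y X≤Y′) ,
  restrict-surjective X∈ X≢0
  where open OrientedMatroid om
        open Uniform chain bases
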